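{- For every $n\geq 0$, the map $\psi$ restricts to a bijection from $\mathcal{B}_n$ onto the set $\mathcal{M}_n$ of Motzkin paths of length $n$, where $\mathcal{B}_n$ is the set of Łukasiewicz paths of length $n$ having no flat step $F$ at positive height.
   Context: A Łukasiewicz path of length $n$ is a sequence of $n$ steps from $\{(1,i): i\geq -1\}$ starting at $(0,0)$, ending at $(n,0)$ and never going below the $x$-axis; a Motzkin path is one whose steps lie in $\{U,F,D\}$. Write $D=(1,-1)$, $F=(1,0)$, $U=U_1=(1,1)$, $U_k=(1,k)$; $\epsilon$ is the empty path. The height of a step is the minimal ordinate of its endpoints. Every nonempty Łukasiewicz path is uniquely either $FL$ or $U_kL_1DL_2D\cdots L_kDL$ with $k\geq1$ and $L,L_1,\dots,L_k$ Łukasiewicz paths (translated vertically). The map $\psi$ from Łukasiewicz paths to Motzkin paths is defined recursively by $\psi(\epsilon)=\epsilon$, $\psi(FL)=F\psi(L)$, and $\psi(U_kL_1DL_2D\cdots L_kDL)=U\psi(L_1)F\psi(L_2)F\cdots F\psi(L_k)D\psi(L)$ (i.e. $U$, then $\psi(L_1),\dots,\psi(L_k)$ separated by $F$ steps, then $D$, then $\psi(L)$). -}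

module Defs where

open import Data.Nat using (ℕ; zero; suc; _+_; _∸_)
open import Data.List using (List; []; _∷_; _++_; length)
open import Data.Product using (_×_; _,_; proj₁; Σ)
open import Data.Unit using (⊤)
open import Relation.Binary.PropositionalEquality using (_≡_)

-- Łukasiewicz steps (1,i), i ≥ -1:
--   down    = D   = (1,-1)
--   up 0    = F   = (1,0)
--   up k    = U_k = (1,k)   (k ≥ 1)
data LStep : Set where
  down : LStep
  up   : ℕ → LStep

data MStep : Set where
  U F D : MStep

-- LukFrom h w : the step sequence w, started at height h, never goes
-- below the x-axis and ends at height 0.
data LukFrom : ℕ → List LStep → Set where
  end : LukFrom 0 []
  dn  : ∀ {h w} → LukFrom h w → LukFrom (suc h) (down ∷ w)
  upk : ∀ {h k w} → LukFrom (k + h) w → LukFrom h (up k ∷ w)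

IsLuk : List LStep → Set
IsLuk w = LukFrom 0 w

data MotzFrom : ℕ → List MStep → Set where
  end : MotzFrom 0 []
  stU : ∀ {h w} → MotzFrom (suc h) w → MotzFrom h (U ∷ w)
  stF : ∀ {h w} → MotzFrom h w → MotzFrom h (F ∷ w)
  stD : ∀ {h w} → MotzFrom h w → MotzFrom (suc h) (D ∷ w)

IsMotz : List MStep → Set
IsMotz m = MotzFrom 0 m

-- NoFlatPos h w : walking w from height h, every flat step F occurs at
-- height 0 (the height of an F step is the common ordinate of its ends).
NoFlatPos : ℕ → List LStep → Set
NoFlatPos h []             = ⊤
NoFlatPos h (down ∷ w)     = NoFlatPos (h ∸ 1) w
NoFlatPos h (up zero ∷ w)  = (h ≡ 0) × NoFlatPos h w
NoFlatPos h (up (suc k) ∷ w) = NoFlatPos (h + suc k) w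

InB : ℕ → List LStep → Set
InB n w = IsLuk w × (length w ≡ n) × NoFlatPos 0 w

InM : ℕ → List MStep → Set
InM n m = IsMotz m × (length m ≡ n)

-- The map ψ, following the recursive decomposition
--   L = F L'   or   L = U_k L_1 D L_2 D ⋯ L_k D L'
-- where each L_i (and L') is a maximal Łukasiewicz prefix (at relative
-- level 0) of the remaining steps.  The first argument is fuel
-- (structural termination only); length w fuel always suffices.

mutual
  -- parse a maximal Łukasiewicz prefix; return ψ of it and the remainder
  pL : ℕ → List LStep → List MStep × List LStep
  pL zero    w               = [] , w
  pL (suc f) []              = [] , []
  pL (suc f) (down ∷ w)      = [] , down ∷ w
  pL (suc f) (up zero ∷ w)   = fcons (pL f w)
  pL (suc f) (up (suc k) ∷ w) = ucons f (pKids f k w)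

  fcons : List MStep × List LStep → List MStep × List LStep
  fcons (m , r) = F ∷ m , r

  ucons : ℕ → List MStep × List LStep → List MStep × List LStep
  ucons f (m , r) = dcons m (pL f r)

  dcons : List MStep → List MStep × List LStep → List MStep × List LStep
  dcons m (m' , r') = U ∷ m ++ D ∷ m' , r'

  -- parse L_1 D L_2 D ⋯ L_{k+1} D, returning ψ(L_1) F ψ(L_2) F ⋯ F ψ(L_{k+1})
  pKids : ℕ → ℕ → List LStep → List MStep × List LStep
  pKids f k w = kidsAfter f k (pL f w)

  kidsAfter : ℕ → ℕ → List MStep × List LStep → List MStep × List LStep
  kidsAfter f zero    (m , down ∷ r) = m , r
  kidsAfter f (suc k) (m , down ∷ r) = sep m (pKids f k r)
  kidsAfter f k       (m , r)        = m , r   -- ill-formed input (not reached on Łukasiewicz paths)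

  sep : List MStep → List MStep × List LStep → List MStep × List LStep
  sep m (m₂ , r₂) = m ++ F ∷ m₂ , r₂

ψ : List LStep → List MStep
ψ w = proj₁ (pL (length w) w)

module Submission where

-- A Łukasiewicz path is the preorder code of a plane tree, and
-- a Motzkin path that of a tree built from "F then a path" and "U a D then a
-- path".  On trees ψ is a relabelling: the children of a U_k-node are joined
-- by F steps.  It is inverted by cutting the part under a U step at its
-- height-0 flat steps; this recovers the children exactly when no child
-- contains an F step.  The F steps of a Łukasiewicz path at height 0 are
-- exactly those on the spine of its tree, so this is the condition defining 𝓑ₙ.

open import Defs
open import Data.Nat using (ℕ; zero; suc; _+_; _≤_; s≤s)
open import Data.Nat.Properties
  using (+-suc; +-comm; +-assoc; +-identityʳ; m+n≤o⇒m≤o; m+n≤o⇒n≤o; n≤1+n; ≤-trans; ≤-refl)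
open import Data.List using (List; []; _∷_; _++_; length)
open import Data.List.Properties using (++-assoc; ++-identityʳ; length-++; ∷-injectiveʳ)
open import Data.Product using (_×_; Σ; _,_; proj₁)
open import Data.Unit using (⊤; tt)
open import Data.Empty using (⊥; ⊥-elim)
open import Function using (_∘_; id)
open import Relation.Binary.PropositionalEquality
  using (_≡_; refl; sym; trans; cong; cong₂; subst; module ≡-Reasoning)

open ≡-Reasoning

-- Łukasiewicz trees

-- node ks t codes U_k L₁ D ⋯ L_k D L with ks = L₁ ⋯ L_k and t = L.
mutual
  data LTree : Set where
    leaf : LTree
    flat : LTree → LTree
    node : Kids → LTree → LTree

  data Kids : Set where
    kid  : LTree → Kids
    _∷ᴷ_ : LTree → Kids → Kids

extraKids : Kids → ℕ
extraKids (kid _)   = 0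
extraKids (_ ∷ᴷ ks) = suc (extraKids ks)

mutual
  lukPath : LTree → List LStep → List LStep
  lukPath leaf        r = r
  lukPath (flat t)    r = up 0 ∷ lukPath t r
  lukPath (node ks t) r = up (suc (extraKids ks)) ∷ kidsPath ks (lukPath t r)

  kidsPath : Kids → List LStep → List LStep
  kidsPath (kid t)   r = lukPath t (down ∷ r)
  kidsPath (t ∷ᴷ ks) r = lukPath t (down ∷ kidsPath ks r)

mutual
  ψᵀ : LTree → List MStep
  ψᵀ leaf        = []
  ψᵀ (flat t)    = F ∷ ψᵀ t
  ψᵀ (node ks t) = U ∷ ψᴷ ks ++ D ∷ ψᵀ t

  ψᴷ : Kids → List MStep
  ψᴷ (kid t)   = ψᵀ t
  ψᴷ (t ∷ᴷ ks) = ψᵀ t ++ F ∷ ψᴷ ks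

mutual
  size : LTree → ℕ
  size leaf        = 0
  size (flat t)    = suc (size t)
  size (node ks t) = suc (kidsSize ks + suc (size t))

  kidsSize : Kids → ℕ
  kidsSize (kid t)   = size t
  kidsSize (t ∷ᴷ ks) = size t + suc (kidsSize ks)

mutual
  length-lukPath : ∀ t r → length (lukPath t r) ≡ size t + length r
  length-lukPath leaf        r = refl
  length-lukPath (flat t)    r = cong suc (length-lukPath t r)
  length-lukPath (node ks t) r = cong suc (begin
    length (kidsPath ks (lukPath t r))          ≡⟨ length-kidsPath ks (lukPath t r) ⟩
    kidsSize ks + suc (length (lukPath t r))    ≡⟨ cong (λ n → kidsSize ks + suc n) (length-lukPath t r) ⟩
    kidsSize ks + (suc (size t) + length r)     ≡⟨ +-assoc (kidsSize ks) (suc (size t)) (length r) ⟨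
    kidsSize ks + suc (size t) + length r       ∎)

  length-kidsPath : ∀ ks r → length (kidsPath ks r) ≡ kidsSize ks + suc (length r)
  length-kidsPath (kid t)   r = length-lukPath t (down ∷ r)
  length-kidsPath (t ∷ᴷ ks) r = begin
    length (lukPath t (down ∷ kidsPath ks r))        ≡⟨ length-lukPath t (down ∷ kidsPath ks r) ⟩
    size t + suc (length (kidsPath ks r))            ≡⟨ cong (λ n → size t + suc n) (length-kidsPath ks r) ⟩
    size t + (suc (kidsSize ks) + suc (length r))    ≡⟨ +-assoc (size t) (suc (kidsSize ks)) (suc (length r)) ⟨
    size t + suc (kidsSize ks) + suc (length r)      ∎

mutual
  length-ψᵀ : ∀ t → length (ψᵀ t) ≡ size t
  length-ψᵀ leaf        = refl
  length-ψᵀ (flat t)    = cong suc (length-ψᵀ t)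
  length-ψᵀ (node ks t) = cong suc (trans (length-++ (ψᴷ ks))
    (cong₂ (λ a b → a + suc b) (length-ψᴷ ks) (length-ψᵀ t)))

  length-ψᴷ : ∀ ks → length (ψᴷ ks) ≡ kidsSize ks
  length-ψᴷ (kid t)   = length-ψᵀ t
  length-ψᴷ (t ∷ᴷ ks) = trans (length-++ (ψᵀ t))
    (cong₂ (λ a b → a + suc b) (length-ψᵀ t) (length-ψᴷ ks))

DownOrEnd : List LStep → Set
DownOrEnd []           = ⊤
DownOrEnd (down ∷ _)   = ⊤
DownOrEnd (up _ ∷ _)   = ⊥

mutual
  pL-lukPath : ∀ f t r → DownOrEnd r → size t ≤ f → pL f (lukPath t r) ≡ (ψᵀ t , r)
  pL-lukPath zero    leaf r          _ _ = refl
  pL-lukPath (suc f) leaf []         _ _ = refl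
  pL-lukPath (suc f) leaf (down ∷ r) _ _ = refl
  pL-lukPath (suc f) (flat t) r stop (s≤s t≤f) = cong fcons (pL-lukPath f t r stop t≤f)
  pL-lukPath (suc f) (node ks t) r stop (s≤s le) = begin
    ucons f (pKids f (extraKids ks) (kidsPath ks (lukPath t r)))
      ≡⟨ cong (ucons f) (pKids-kidsPath f ks (lukPath t r) (m+n≤o⇒m≤o (kidsSize ks) le)) ⟩
    dcons (ψᴷ ks) (pL f (lukPath t r))
      ≡⟨ cong (dcons (ψᴷ ks)) (pL-lukPath f t r stop (≤-trans (n≤1+n (size t)) (m+n≤o⇒n≤o (kidsSize ks) le))) ⟩
    (ψᵀ (node ks t) , r) ∎

  pKids-kidsPath : ∀ f ks r → kidsSize ks ≤ f → pKids f (extraKids ks) (kidsPath ks r) ≡ (ψᴷ ks , r)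
  pKids-kidsPath f (kid t) r le = cong (kidsAfter f 0) (pL-lukPath f t (down ∷ r) tt le)
  pKids-kidsPath f (t ∷ᴷ ks) r le = begin
    kidsAfter f (suc (extraKids ks)) (pL f (lukPath t (down ∷ kidsPath ks r)))
      ≡⟨ cong (kidsAfter f (suc (extraKids ks))) (pL-lukPath f t _ tt (m+n≤o⇒m≤o (size t) le)) ⟩
    sep (ψᵀ t) (pKids f (extraKids ks) (kidsPath ks r))
      ≡⟨ cong (sep (ψᵀ t)) (pKids-kidsPath f ks r (≤-trans (n≤1+n _) (m+n≤o⇒n≤o (size t) le))) ⟩
    (ψᴷ (t ∷ᴷ ks) , r) ∎

ψ-lukPath : ∀ t → ψ (lukPath t []) ≡ ψᵀ t
ψ-lukPath t = cong proj₁ (pL-lukPath (length (lukPath t [])) t [] tt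
  (subst (size t ≤_) (sym (trans (length-lukPath t []) (+-identityʳ (size t)))) ≤-refl))

mutual
  lukPath-isLuk : ∀ t {h r} → LukFrom h r → LukFrom h (lukPath t r)
  lukPath-isLuk leaf        p = p
  lukPath-isLuk (flat t)    p = upk (lukPath-isLuk t p)
  lukPath-isLuk (node ks t) p = upk (kidsPath-isLuk ks (lukPath-isLuk t p))

  kidsPath-isLuk : ∀ ks {h r} → LukFrom h r → LukFrom (suc (extraKids ks) + h) (kidsPath ks r)
  kidsPath-isLuk (kid t)   p = lukPath-isLuk t (dn p)
  kidsPath-isLuk (t ∷ᴷ ks) p = lukPath-isLuk t (dn (kidsPath-isLuk ks p))

-- A Łukasiewicz path from height h is t₀ D t₁ D ⋯ D t_h; the stack lists t₀, …, t_h.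
data Stack : ℕ → Set where
  bottom : LTree → Stack 0
  push   : ∀ {h} → LTree → Stack h → Stack (suc h)

stackPath : ∀ {h} → Stack h → List LStep
stackPath (bottom t) = lukPath t []
stackPath (push t s) = lukPath t (down ∷ stackPath s)

mapTop : ∀ {h} → (LTree → LTree) → Stack h → Stack h
mapTop f (bottom t) = bottom (f t)
mapTop f (push t s) = push (f t) s

stackPath-mapTop : ∀ {h} {f : LTree → LTree} {g : List LStep → List LStep} →
                   (∀ t r → lukPath (f t) r ≡ g (lukPath t r)) →
                   (s : Stack h) → stackPath (mapTop f s) ≡ g (stackPath s)
stackPath-mapTop f≈g (bottom t) = f≈g t []
stackPath-mapTop f≈g (push t s) = f≈g t (down ∷ stackPath s)

popKids : ∀ k {h} (s : Stack (suc (k + h))) →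
          Σ Kids λ ks → Σ (Stack h) λ rest →
          (extraKids ks ≡ k) × (kidsPath ks (stackPath rest) ≡ stackPath s)
popKids zero    (push t s) = kid t , s , refl , refl
popKids (suc k) (push t s) with popKids k s
... | ks , rest , refl , eq = t ∷ᴷ ks , rest , refl , cong (lukPath t ∘ (down ∷_)) eq

parseLuk : ∀ {h w} → LukFrom h w → Σ (Stack h) λ s → stackPath s ≡ w
parseLuk end = bottom leaf , refl
parseLuk (dn p) with parseLuk p
... | s , refl = push leaf s , refl
parseLuk (upk {k = zero} p) with parseLuk p
... | s , refl = mapTop flat s , stackPath-mapTop {g = up 0 ∷_} (λ _ _ → refl) s
parseLuk (upk {k = suc k} p) with parseLuk p
... | s , refl with popKids k s
... | ks , rest , refl , eq = mapTop (node ks) rest ,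
      trans (stackPath-mapTop {g = λ r → up (suc k) ∷ kidsPath ks r} (λ _ _ → refl) rest) (cong (up (suc k) ∷_) eq)

lukTree : ∀ {w} → IsLuk w → Σ LTree λ t → lukPath t [] ≡ w
lukTree p with parseLuk p
... | bottom t , eq = t , eq

-- Motzkin trees: first-return decomposition of Motzkin paths

data MTree : Set where
  mleaf : MTree
  mflat : MTree → MTree
  mpeak : MTree → MTree → MTree

motzPath : MTree → List MStep → List MStep
motzPath mleaf       r = r
motzPath (mflat a)   r = F ∷ motzPath a r
motzPath (mpeak a b) r = U ∷ motzPath a (D ∷ motzPath b r)

infixr 5 _⊕_
_⊕_ : MTree → MTree → MTree
mleaf     ⊕ y = y
mflat a   ⊕ y = mflat (a ⊕ y)
mpeak a b ⊕ y = mpeak a (b ⊕ y)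

motzPath-⊕ : ∀ x y r → motzPath (x ⊕ y) r ≡ motzPath x (motzPath y r)
motzPath-⊕ mleaf       y r = refl
motzPath-⊕ (mflat a)   y r = cong (F ∷_) (motzPath-⊕ a y r)
motzPath-⊕ (mpeak a b) y r = cong (λ z → U ∷ motzPath a (D ∷ z)) (motzPath-⊕ b y r)

⊕-identityʳ : ∀ x → x ⊕ mleaf ≡ x
⊕-identityʳ mleaf       = refl
⊕-identityʳ (mflat a)   = cong mflat (⊕-identityʳ a)
⊕-identityʳ (mpeak a b) = cong (mpeak a) (⊕-identityʳ b)

motzPath-isMotz : ∀ T {h r} → MotzFrom h r → MotzFrom h (motzPath T r)
motzPath-isMotz mleaf       p = p
motzPath-isMotz (mflat a)   p = stF (motzPath-isMotz a p)
motzPath-isMotz (mpeak a b) p = stU (motzPath-isMotz a (stD (motzPath-isMotz b p)))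

data MStack : ℕ → Set where
  mbottom : MTree → MStack 0
  mpush   : ∀ {h} → MTree → MStack h → MStack (suc h)

mstackPath : ∀ {h} → MStack h → List MStep
mstackPath (mbottom T) = motzPath T []
mstackPath (mpush T s) = motzPath T (D ∷ mstackPath s)

mapMTop : ∀ {h} → (MTree → MTree) → MStack h → MStack h
mapMTop f (mbottom T) = mbottom (f T)
mapMTop f (mpush T s) = mpush (f T) s

mstackPath-mapMTop : ∀ {h} {f : MTree → MTree} {g : List MStep → List MStep} →
                     (∀ T r → motzPath (f T) r ≡ g (motzPath T r)) →
                     (s : MStack h) → mstackPath (mapMTop f s) ≡ g (mstackPath s)
mstackPath-mapMTop f≈g (mbottom T) = f≈g T []
mstackPath-mapMTop f≈g (mpush T s) = f≈g T (D ∷ mstackPath s)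

parseMotz : ∀ {h m} → MotzFrom h m → Σ (MStack h) λ s → mstackPath s ≡ m
parseMotz end = mbottom mleaf , refl
parseMotz (stF p) with parseMotz p
... | s , refl = mapMTop mflat s , mstackPath-mapMTop {g = F ∷_} (λ _ _ → refl) s
parseMotz (stD p) with parseMotz p
... | s , refl = mpush mleaf s , refl
parseMotz (stU p) with parseMotz p
... | mpush a s , refl = mapMTop (mpeak a) s , mstackPath-mapMTop {g = λ r → U ∷ motzPath a (D ∷ r)} (λ _ _ → refl) s

motzTree : ∀ {m} → IsMotz m → Σ MTree λ T → motzPath T [] ≡ m
motzTree p with parseMotz p
... | mbottom T , eq = T , eq

DownOrEndᴹ : List MStep → Set
DownOrEndᴹ []      = ⊤
DownOrEndᴹ (D ∷ _) = ⊤
DownOrEndᴹ (U ∷ _) = ⊥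
DownOrEndᴹ (F ∷ _) = ⊥

motzPath-injective : ∀ T T′ {r r′} → DownOrEndᴹ r → DownOrEndᴹ r′ →
                     motzPath T r ≡ motzPath T′ r′ → T ≡ T′ × r ≡ r′
motzPath-injective mleaf     mleaf       _  _  eq = refl , eq
motzPath-injective mleaf     (mflat _)   st _  eq = ⊥-elim (subst DownOrEndᴹ eq st)
motzPath-injective mleaf     (mpeak _ _) st _  eq = ⊥-elim (subst DownOrEndᴹ eq st)
motzPath-injective (mflat _)   mleaf     _  st eq = ⊥-elim (subst DownOrEndᴹ (sym eq) st)
motzPath-injective (mpeak _ _) mleaf     _  st eq = ⊥-elim (subst DownOrEndᴹ (sym eq) st)
motzPath-injective (mflat a) (mflat a′) st st′ eq
  with motzPath-injective a a′ st st′ (∷-injectiveʳ eq)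
... | refl , r≡r′ = refl , r≡r′
motzPath-injective (mpeak a b) (mpeak a′ b′) st st′ eq
  with motzPath-injective a a′ tt tt (∷-injectiveʳ eq)
... | refl , rest≡rest′ with motzPath-injective b b′ st st′ (∷-injectiveʳ rest≡rest′)
... | refl , r≡r′ = refl , r≡r′

mutual
  motz : LTree → MTree
  motz leaf        = mleaf
  motz (flat t)    = mflat (motz t)
  motz (node ks t) = mpeak (motzKids ks) (motz t)

  motzKids : Kids → MTree
  motzKids (kid t)   = motz t
  motzKids (t ∷ᴷ ks) = motz t ⊕ mflat (motzKids ks)

mutual
  ψᵀ-++ : ∀ t r → ψᵀ t ++ r ≡ motzPath (motz t) r
  ψᵀ-++ leaf        r = refl
  ψᵀ-++ (flat t)    r = cong (F ∷_) (ψᵀ-++ t r)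
  ψᵀ-++ (node ks t) r = cong (U ∷_) (begin
    (ψᴷ ks ++ D ∷ ψᵀ t) ++ r                ≡⟨ ++-assoc (ψᴷ ks) (D ∷ ψᵀ t) r ⟩
    ψᴷ ks ++ D ∷ ψᵀ t ++ r                  ≡⟨ cong (λ z → ψᴷ ks ++ D ∷ z) (ψᵀ-++ t r) ⟩
    ψᴷ ks ++ D ∷ motzPath (motz t) r        ≡⟨ ψᴷ-++ ks (D ∷ motzPath (motz t) r) ⟩
    motzPath (motzKids ks) (D ∷ motzPath (motz t) r) ∎)

  ψᴷ-++ : ∀ ks r → ψᴷ ks ++ r ≡ motzPath (motzKids ks) r
  ψᴷ-++ (kid t)   r = ψᵀ-++ t r
  ψᴷ-++ (t ∷ᴷ ks) r = begin
    (ψᵀ t ++ F ∷ ψᴷ ks) ++ r                      ≡⟨ ++-assoc (ψᵀ t) (F ∷ ψᴷ ks) r ⟩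
    ψᵀ t ++ F ∷ ψᴷ ks ++ r                        ≡⟨ cong (λ z → ψᵀ t ++ F ∷ z) (ψᴷ-++ ks r) ⟩
    ψᵀ t ++ F ∷ motzPath (motzKids ks) r          ≡⟨ ψᵀ-++ t _ ⟩
    motzPath (motz t) (F ∷ motzPath (motzKids ks) r) ≡⟨ motzPath-⊕ (motz t) (mflat (motzKids ks)) r ⟨
    motzPath (motzKids (t ∷ᴷ ks)) r               ∎

ψ-lukPath-motz : ∀ t → ψ (lukPath t []) ≡ motzPath (motz t) []
ψ-lukPath-motz t = begin
  ψ (lukPath t [])         ≡⟨ ψ-lukPath t ⟩
  ψᵀ t                     ≡⟨ ++-identityʳ (ψᵀ t) ⟨
  ψᵀ t ++ []               ≡⟨ ψᵀ-++ t [] ⟩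
  motzPath (motz t) []     ∎

-- Flat steps at positive height

mutual
  FlatFree : LTree → Set
  FlatFree leaf        = ⊤
  FlatFree (flat _)    = ⊥
  FlatFree (node ks t) = FlatFreeKids ks × FlatFree t

  FlatFreeKids : Kids → Set
  FlatFreeKids (kid t)   = FlatFree t
  FlatFreeKids (t ∷ᴷ ks) = FlatFree t × FlatFreeKids ks

FlatOnlyOnSpine : LTree → Set
FlatOnlyOnSpine leaf        = ⊤
FlatOnlyOnSpine (flat t)    = FlatOnlyOnSpine t
FlatOnlyOnSpine (node ks t) = FlatFreeKids ks × FlatOnlyOnSpine t

mutual
  noFlatPos-lukPath⁻ : ∀ h t r → NoFlatPos (suc h) (lukPath t r) → FlatFree t × NoFlatPos (suc h) r
  noFlatPos-lukPath⁻ h leaf        r p = tt , p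
  noFlatPos-lukPath⁻ h (flat t)    r (() , _)
  noFlatPos-lukPath⁻ h (node ks t) r p with noFlatPos-kidsPath⁻ (suc h) ks (lukPath t r) p
  ... | ffks , q with noFlatPos-lukPath⁻ h t r q
  ... | fft , q′ = (ffks , fft) , q′

  noFlatPos-kidsPath⁻ : ∀ h ks r → NoFlatPos (h + suc (extraKids ks)) (kidsPath ks r) →
                        FlatFreeKids ks × NoFlatPos h r
  noFlatPos-kidsPath⁻ h (kid t) r p =
    noFlatPos-lukPath⁻ h t (down ∷ r) (subst (λ x → NoFlatPos x (lukPath t (down ∷ r))) (+-comm h 1) p)
  noFlatPos-kidsPath⁻ h (t ∷ᴷ ks) r p
    with noFlatPos-lukPath⁻ _ t (down ∷ kidsPath ks r)
           (subst (λ x → NoFlatPos x (lukPath t (down ∷ kidsPath ks r))) (+-suc h (suc (extraKids ks))) p)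
  ... | fft , q with noFlatPos-kidsPath⁻ h ks r q
  ... | ffks , q′ = (fft , ffks) , q′

mutual
  noFlatPos-lukPath⁺ : ∀ h t r → FlatFree t → NoFlatPos (suc h) r → NoFlatPos (suc h) (lukPath t r)
  noFlatPos-lukPath⁺ h leaf        r _           p = p
  noFlatPos-lukPath⁺ h (node ks t) r (ffks , fft) p =
    noFlatPos-kidsPath⁺ (suc h) ks (lukPath t r) ffks (noFlatPos-lukPath⁺ h t r fft p)

  noFlatPos-kidsPath⁺ : ∀ h ks r → FlatFreeKids ks → NoFlatPos h r →
                        NoFlatPos (h + suc (extraKids ks)) (kidsPath ks r)
  noFlatPos-kidsPath⁺ h (kid t) r fft p =
    subst (λ x → NoFlatPos x (lukPath t (down ∷ r))) (+-comm 1 h) (noFlatPos-lukPath⁺ h t (down ∷ r) fft p)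
  noFlatPos-kidsPath⁺ h (t ∷ᴷ ks) r (fft , ffks) p =
    subst (λ x → NoFlatPos x (lukPath t (down ∷ kidsPath ks r))) (sym (+-suc h (suc (extraKids ks))))
      (noFlatPos-lukPath⁺ _ t (down ∷ kidsPath ks r) fft (noFlatPos-kidsPath⁺ h ks r ffks p))

noFlatPos-spine⁻ : ∀ t r → NoFlatPos 0 (lukPath t r) → FlatOnlyOnSpine t × NoFlatPos 0 r
noFlatPos-spine⁻ leaf        r p       = tt , p
noFlatPos-spine⁻ (flat t)    r (_ , p) = noFlatPos-spine⁻ t r p
noFlatPos-spine⁻ (node ks t) r p with noFlatPos-kidsPath⁻ 0 ks (lukPath t r) p
... | ffks , q with noFlatPos-spine⁻ t r q
... | spine , q′ = (ffks , spine) , q′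

noFlatPos-spine⁺ : ∀ t r → FlatOnlyOnSpine t → NoFlatPos 0 r → NoFlatPos 0 (lukPath t r)
noFlatPos-spine⁺ leaf        r _              p = p
noFlatPos-spine⁺ (flat t)    r spine          p = refl , noFlatPos-spine⁺ t r spine p
noFlatPos-spine⁺ (node ks t) r (ffks , spine) p =
  noFlatPos-kidsPath⁺ 0 ks (lukPath t r) ffks (noFlatPos-spine⁺ t r spine p)

mapFirstKid : (LTree → LTree) → Kids → Kids
mapFirstKid f (kid t)   = kid (f t)
mapFirstKid f (t ∷ᴷ ks) = f t ∷ᴷ ks

mapFirstKid-id : ∀ ks → mapFirstKid id ks ≡ ks
mapFirstKid-id (kid _)   = refl
mapFirstKid-id (_ ∷ᴷ _)  = refl

mapFirstKid-∘ : ∀ f g ks → mapFirstKid f (mapFirstKid g ks) ≡ mapFirstKid (f ∘ g) ks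
mapFirstKid-∘ f g (kid _)  = refl
mapFirstKid-∘ f g (_ ∷ᴷ _) = refl

-- Cut a Motzkin tree at its height-0 flat steps.
unmotzKids : MTree → Kids
unmotzKids mleaf       = kid leaf
unmotzKids (mflat a)   = leaf ∷ᴷ unmotzKids a
unmotzKids (mpeak a b) = mapFirstKid (node (unmotzKids a)) (unmotzKids b)

unmotz : MTree → LTree
unmotz mleaf       = leaf
unmotz (mflat a)   = flat (unmotz a)
unmotz (mpeak a b) = node (unmotzKids a) (unmotz b)

graft : LTree → LTree → LTree
graft leaf        s = s
graft (flat t)    s = flat (graft t s)
graft (node ks t) s = node ks (graft t s)

graft-leaf : ∀ t → graft t leaf ≡ t
graft-leaf leaf        = refl
graft-leaf (flat t)    = cong flat (graft-leaf t)
graft-leaf (node ks t) = cong (node ks) (graft-leaf t)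

mutual
  unmotzKids-⊕ : ∀ t y → FlatFree t → unmotzKids (motz t ⊕ y) ≡ mapFirstKid (graft t) (unmotzKids y)
  unmotzKids-⊕ leaf        y _            = sym (mapFirstKid-id (unmotzKids y))
  unmotzKids-⊕ (node ks t) y (ffks , fft) = begin
    mapFirstKid (node (unmotzKids (motzKids ks))) (unmotzKids (motz t ⊕ y))
      ≡⟨ cong₂ (mapFirstKid ∘ node) (unmotzKids-motzKids ks ffks) (unmotzKids-⊕ t y fft) ⟩
    mapFirstKid (node ks) (mapFirstKid (graft t) (unmotzKids y))
      ≡⟨ mapFirstKid-∘ (node ks) (graft t) (unmotzKids y) ⟩
    mapFirstKid (graft (node ks t)) (unmotzKids y) ∎

  unmotzKids-motzKids : ∀ ks → FlatFreeKids ks → unmotzKids (motzKids ks) ≡ ks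
  unmotzKids-motzKids (kid t) fft = begin
    unmotzKids (motz t)          ≡⟨ cong unmotzKids (⊕-identityʳ (motz t)) ⟨
    unmotzKids (motz t ⊕ mleaf)  ≡⟨ unmotzKids-⊕ t mleaf fft ⟩
    kid (graft t leaf)           ≡⟨ cong kid (graft-leaf t) ⟩
    kid t                        ∎
  unmotzKids-motzKids (t ∷ᴷ ks) (fft , ffks) =
    trans (unmotzKids-⊕ t (mflat (motzKids ks)) fft)
          (cong₂ _∷ᴷ_ (graft-leaf t) (unmotzKids-motzKids ks ffks))

unmotz-motz : ∀ t → FlatOnlyOnSpine t → unmotz (motz t) ≡ t
unmotz-motz leaf        _              = refl
unmotz-motz (flat t)    spine          = cong flat (unmotz-motz t spine)
unmotz-motz (node ks t) (ffks , spine) = cong₂ node (unmotzKids-motzKids ks ffks) (unmotz-motz t spine)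

motzKids-mapFirstKid-node : ∀ ks ks′ → motzKids (mapFirstKid (node ks) ks′) ≡ mpeak (motzKids ks) (motzKids ks′)
motzKids-mapFirstKid-node ks (kid _)  = refl
motzKids-mapFirstKid-node ks (_ ∷ᴷ _) = refl

motzKids-unmotzKids : ∀ T → motzKids (unmotzKids T) ≡ T
motzKids-unmotzKids mleaf       = refl
motzKids-unmotzKids (mflat a)   = cong mflat (motzKids-unmotzKids a)
motzKids-unmotzKids (mpeak a b) = trans (motzKids-mapFirstKid-node (unmotzKids a) (unmotzKids b))
  (cong₂ mpeak (motzKids-unmotzKids a) (motzKids-unmotzKids b))

motz-unmotz : ∀ T → motz (unmotz T) ≡ T
motz-unmotz mleaf       = refl
motz-unmotz (mflat a)   = cong mflat (motz-unmotz a)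
motz-unmotz (mpeak a b) = cong₂ mpeak (motzKids-unmotzKids a) (motz-unmotz b)

flatFreeKids-mapFirstKid-node : ∀ ks ks′ → FlatFreeKids ks → FlatFreeKids ks′ →
                                FlatFreeKids (mapFirstKid (node ks) ks′)
flatFreeKids-mapFirstKid-node ks (kid _)   ffks fft          = ffks , fft
flatFreeKids-mapFirstKid-node ks (_ ∷ᴷ _) ffks (fft , ffks′) = (ffks , fft) , ffks′

flatFreeKids-unmotzKids : ∀ T → FlatFreeKids (unmotzKids T)
flatFreeKids-unmotzKids mleaf       = tt
flatFreeKids-unmotzKids (mflat a)   = tt , flatFreeKids-unmotzKids a
flatFreeKids-unmotzKids (mpeak a b) = flatFreeKids-mapFirstKid-node (unmotzKids a) (unmotzKids b)
  (flatFreeKids-unmotzKids a) (flatFreeKids-unmotzKids b)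

flatOnlyOnSpine-unmotz : ∀ T → FlatOnlyOnSpine (unmotz T)
flatOnlyOnSpine-unmotz mleaf       = tt
flatOnlyOnSpine-unmotz (mflat a)   = flatOnlyOnSpine-unmotz a
flatOnlyOnSpine-unmotz (mpeak a b) = flatFreeKids-unmotzKids a , flatOnlyOnSpine-unmotz b

length-ψ-lukPath : ∀ t → length (ψ (lukPath t [])) ≡ length (lukPath t [])
length-ψ-lukPath t = begin
  length (ψ (lukPath t []))  ≡⟨ cong length (ψ-lukPath t) ⟩
  length (ψᵀ t)              ≡⟨ length-ψᵀ t ⟩
  size t                     ≡⟨ +-identityʳ (size t) ⟨
  size t + 0                 ≡⟨ length-lukPath t [] ⟨
  length (lukPath t [])      ∎

ψ-maps-B-to-M : ∀ n w → InB n w → InM n (ψ w)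
ψ-maps-B-to-M n w (luk , len , _) with lukTree luk
... | t , refl = subst IsMotz (sym (ψ-lukPath-motz t)) (motzPath-isMotz (motz t) end)
               , trans (length-ψ-lukPath t) len

ψ-injective-on-B : ∀ n w w′ → InB n w → InB n w′ → ψ w ≡ ψ w′ → w ≡ w′
ψ-injective-on-B n w w′ (luk , _ , nf) (luk′ , _ , nf′) eq with lukTree luk | lukTree luk′
... | t , refl | t′ , refl = cong (λ s → lukPath s []) (begin
  t                ≡⟨ unmotz-motz t (proj₁ (noFlatPos-spine⁻ t [] nf)) ⟨
  unmotz (motz t)  ≡⟨ cong unmotz motz-t≡motz-t′ ⟩
  unmotz (motz t′) ≡⟨ unmotz-motz t′ (proj₁ (noFlatPos-spine⁻ t′ [] nf′)) ⟩
  t′               ∎)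
  where
  motz-t≡motz-t′ : motz t ≡ motz t′
  motz-t≡motz-t′ = proj₁ (motzPath-injective (motz t) (motz t′) tt tt
    (trans (sym (ψ-lukPath-motz t)) (trans eq (ψ-lukPath-motz t′))))

ψ-unmotz : ∀ T → ψ (lukPath (unmotz T) []) ≡ motzPath T []
ψ-unmotz T = trans (ψ-lukPath-motz (unmotz T)) (cong (λ z → motzPath z []) (motz-unmotz T))

ψ-onto-M : ∀ n m → InM n m → Σ (List LStep) λ w → InB n w × ψ w ≡ m
ψ-onto-M n m (motzP , len) with motzTree motzP
... | T , refl = lukPath t [] , (lukPath-isLuk t end , length-w , noFlatPos-spine⁺ t [] (flatOnlyOnSpine-unmotz T) tt)
               , ψ-unmotz T
  where
  t = unmotz T
  length-w : length (lukPath t []) ≡ n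
  length-w = trans (sym (length-ψ-lukPath t)) (trans (cong length (ψ-unmotz T)) len)

theorem7 : (n : ℕ)
    → ((w : List LStep) → InB n w → InM n (ψ w))
    × ((w w′ : List LStep) → InB n w → InB n w′ → ψ w ≡ ψ w′ → w ≡ w′)
    × ((m : List MStep) → InM n m → Σ (List LStep) (λ w → InB n w × (ψ w ≡ m)))
theorem7 n = ψ-maps-B-to-M n , ψ-injective-on-B n , ψ-onto-M n
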